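{- Let $t$ be a positive integer, let $m$ be a $t$-representable integer, and let $r=(k;y_1,\dots,y_l)$ be a $t$-translation. Then the number $\mathrm{sc}(r)\cdot m + \mathrm{sh}(r)$ is $t$-representable.
   Context: For a positive integer $t$, an integer $m$ is $t$-representable if there is a finite set $X$ of distinct positive integers with $\min X \geq t$, $\sum_{x\in X}\frac1x = 1$ and $\sum_{x\in X} x^2 = m$. A tuple of positive integers $r=(k;y_1,\dots,y_l)$ is a $t$-translation if $1-\frac1k = \frac1{y_1}+\dots+\frac1{y_l}$, $t\leq y_1<y_2<\dots<y_l$, and for every $i\in\{1,\dots,l\}$ either $y_i < tk$ or $k\nmid y_i$. Its scale is $\mathrm{sc}(r)=k^2$ and its shift is $\mathrm{sh}(r)=y_1^2+\dots+y_l^2$. -}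

module Defs where

open import Data.Nat using (ℕ; zero; suc; _+_; _*_; _≤_; _<_)
open import Data.Nat.Divisibility using (_∣_)
open import Data.Nat.ListAction using (sum)
open import Data.Integer using (+_)
open import Data.Rational using (ℚ; _/_; 0ℚ; 1ℚ) renaming (_+_ to _+ℚ_; _-_ to _-ℚ_)
open import Data.List using (List; []; _∷_; map; foldr)
open import Data.List.Relation.Unary.All using (All)
open import Data.List.Relation.Unary.Linked using (Linked)
open import Data.Product using (Σ; _×_; ∃-syntax)
open import Data.Sum using (_⊎_)
open import Relation.Binary.PropositionalEquality using (_≡_)
open import Relation.Nullary using (¬_)

-- reciprocal 1/n as a rational (only used for n ≥ 1; 1/0 := 0 is a dummy)
recip : ℕ → ℚ
recip zero    = 0ℚ
recip (suc n) = + 1 / suc n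

recipSum : List ℕ → ℚ
recipSum = foldr (λ x acc → recip x +ℚ acc) 0ℚ

sqSum : List ℕ → ℕ
sqSum xs = sum (map (λ x → x * x) xs)

-- A finite set X of distinct positive integers is represented by a strictly
-- increasing list.
StrictlyIncreasing : List ℕ → Set
StrictlyIncreasing = Linked _<_

Representable : ℕ → ℕ → Set
Representable t m =
  Σ (List ℕ) λ X →
    StrictlyIncreasing X ×
    All (λ x → t ≤ x) X ×
    recipSum X ≡ 1ℚ ×
    sqSum X ≡ m

-- r = (k; y_1, ..., y_l) with ys = [y_1, ..., y_l] is a t-translation
IsTranslation : ℕ → ℕ → List ℕ → Set
IsTranslation t k ys =
  1 ≤ k ×
  1ℚ -ℚ recip k ≡ recipSum ys ×
  All (λ y → t ≤ y) ys ×
  StrictlyIncreasing ys ×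
  All (λ y → y < t * k ⊎ ¬ (k ∣ y)) ys

sc : ℕ → ℕ
sc k = k * k

sh : List ℕ → ℕ
sh = sqSum

{-# OPTIONS --safe #-}
-- Scale a representation X of m by k: the set kX has reciprocal sum 1/k and square
-- sum k²m. Adding the translation's y's restores the reciprocal sum to 1 and adds
-- sh(r) to the square sum. The translation condition (y < tk or k ∤ y) says exactly
-- that no y lies in kX, whose elements are multiples of k that are at least tk; so the
-- merged list is again a set of distinct integers, all at least t.
module Submission where

open import Defs
open import Data.Nat using (ℕ; zero; suc; _+_; _*_; _≤_; _<_; _≤?_)
open import Data.Nat.Properties as ℕ using (≤-decTotalOrder)
open import Data.Nat.Divisibility using (_∣_; m∣m*n)
open import Data.Nat.ListAction.Properties using (sum-++; sum-↭)
import Data.Integer as ℤ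
open import Data.Rational using (ℚ; toℚᵘ; 0ℚ; 1ℚ)
  renaming (_+_ to _+ℚ_; _*_ to _*ℚ_; _-_ to _-ℚ_)
import Data.Rational.Properties as ℚ
import Data.Rational.Unnormalised as ℚᵘ
import Data.Rational.Unnormalised.Properties as ℚᵘ
open import Data.List using (List; []; _∷_; _++_; map; foldr; merge)
open import Data.List.Properties using (map-++; foldr-map)
open import Data.List.Relation.Unary.All as All using (All; []; _∷_)
import Data.List.Relation.Unary.All.Properties as All
open import Data.List.Relation.Unary.AllPairs as AllPairs using ([]; _∷_)
open import Data.List.Relation.Unary.Linked as Linked using (Linked; []; [-]; _∷_)
import Data.List.Relation.Unary.Linked.Properties as Linked
open import Data.List.Relation.Unary.Unique.Propositional using (Unique)
import Data.List.Relation.Unary.Unique.Propositional.Properties as Unique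
open import Data.List.Relation.Unary.Sorted.TotalOrder.Properties using (merge⁺)
open import Data.List.Relation.Binary.Disjoint.Propositional using (Disjoint)
open import Data.List.Relation.Binary.Permutation.Propositional
  using (_↭_; ↭-sym; ↭⇒↭ₛ)
import Data.List.Relation.Binary.Permutation.Propositional.Properties as ↭
import Data.List.Relation.Binary.Permutation.Setoid.Properties as ↭ₛ
open import Data.Product using (_×_; _,_)
open import Data.Sum using (_⊎_; inj₁; inj₂)
open import Data.Nat.Tactic.RingSolver using (solve-∀)
open import Data.Nat.ListAction using (sum)
import Algebra.Properties.Group as GroupProperties
open import Function using (_∘_)
open import Relation.Binary.PropositionalEquality
open import Relation.Nullary using (¬_)

recip-suc≃ : ∀ n → toℚᵘ (recip (suc n)) ℚᵘ.≃ ℚᵘ.mkℚᵘ (ℤ.+ 1) n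
recip-suc≃ n = ℚ.toℚᵘ-fromℚᵘ (ℚᵘ.mkℚᵘ (ℤ.+ 1) n)

recip-* : ∀ a x → recip (suc a * x) ≡ recip (suc a) *ℚ recip x
recip-* a zero    = trans (cong recip (ℕ.*-zeroʳ a)) (sym (ℚ.*-zeroʳ (recip (suc a))))
recip-* a (suc x) = ℚ.toℚᵘ-injective (begin
  toℚᵘ (recip (suc a * suc x))                   ≈⟨ recip-suc≃ (x + a * suc x) ⟩
  ℚᵘ.mkℚᵘ (ℤ.+ 1) (x + a * suc x)                ≈⟨ ℚᵘ.*≡* refl ⟩
  ℚᵘ.mkℚᵘ (ℤ.+ 1) a ℚᵘ.* ℚᵘ.mkℚᵘ (ℤ.+ 1) x       ≈⟨ ℚᵘ.*-cong (recip-suc≃ a) (recip-suc≃ x) ⟨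
  toℚᵘ (recip (suc a)) ℚᵘ.* toℚᵘ (recip (suc x)) ≈⟨ ℚ.toℚᵘ-homo-* (recip (suc a)) (recip (suc x)) ⟨
  toℚᵘ (recip (suc a) *ℚ recip (suc x))          ∎)
  where open ℚᵘ.≃-Reasoning

recipSum-map-* : ∀ a xs → recipSum (map (suc a *_) xs) ≡ recip (suc a) *ℚ recipSum xs
recipSum-map-* a []       = sym (ℚ.*-zeroʳ (recip (suc a)))
recipSum-map-* a (x ∷ xs) = begin
  recip (suc a * x) +ℚ recipSum (map (suc a *_) xs)
    ≡⟨ cong₂ _+ℚ_ (recip-* a x) (recipSum-map-* a xs) ⟩
  recip (suc a) *ℚ recip x +ℚ recip (suc a) *ℚ recipSum xs
    ≡⟨ ℚ.*-distribˡ-+ (recip (suc a)) (recip x) (recipSum xs) ⟨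
  recip (suc a) *ℚ (recip x +ℚ recipSum xs)
    ∎
  where open ≡-Reasoning

recipSum-++ : ∀ xs ys → recipSum (xs ++ ys) ≡ recipSum xs +ℚ recipSum ys
recipSum-++ []       ys = sym (ℚ.+-identityˡ (recipSum ys))
recipSum-++ (x ∷ xs) ys = trans (cong (recip x +ℚ_) (recipSum-++ xs ys))
                                (sym (ℚ.+-assoc (recip x) (recipSum xs) (recipSum ys)))

recipSum-↭ : ∀ {xs ys} → xs ↭ ys → recipSum xs ≡ recipSum ys
recipSum-↭ {xs} {ys} p = begin
  recipSum xs         ≡⟨ as-sum xs ⟩
  sumℚ (map recip xs) ≡⟨ ↭ₛ.foldr-commMonoid (setoid ℚ) ℚ.+-0-isCommutativeMonoid
                           (↭⇒↭ₛ (↭.map⁺ recip p)) ⟩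
  sumℚ (map recip ys) ≡⟨ as-sum ys ⟨
  recipSum ys         ∎
  where
  open ≡-Reasoning
  sumℚ : List ℚ → ℚ
  sumℚ = foldr _+ℚ_ 0ℚ
  as-sum : ∀ zs → recipSum zs ≡ sumℚ (map recip zs)
  as-sum zs = sym (foldr-map _+ℚ_ recip 0ℚ zs)

recipSum-merge : ∀ xs ys → recipSum (merge _≤?_ xs ys) ≡ recipSum xs +ℚ recipSum ys
recipSum-merge xs ys = trans (recipSum-↭ (↭.merge-↭ _≤?_ xs ys)) (recipSum-++ xs ys)

+-[-]-cancel : ∀ p q → p +ℚ (q -ℚ p) ≡ q
+-[-]-cancel p q = trans (ℚ.+-comm p (q -ℚ p)) (//-rightDividesˡ p q)
  where open GroupProperties ℚ.+-0-group using (//-rightDividesˡ)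

sqSum-map-* : ∀ k xs → sqSum (map (k *_) xs) ≡ k * k * sqSum xs
sqSum-map-* k []       = sym (ℕ.*-zeroʳ (k * k))
sqSum-map-* k (x ∷ xs) = trans (cong ((k * x * (k * x)) +_) (sqSum-map-* k xs))
                               (square-distrib k x (sqSum xs))
  where
  square-distrib : ∀ k x s → k * x * (k * x) + k * k * s ≡ k * k * (x * x + s)
  square-distrib = solve-∀

sqSum-++ : ∀ xs ys → sqSum (xs ++ ys) ≡ sqSum xs + sqSum ys
sqSum-++ xs ys = trans (cong sum (map-++ _ xs ys)) (sum-++ (map _ xs) (map _ ys))

sqSum-↭ : ∀ {xs ys} → xs ↭ ys → sqSum xs ≡ sqSum ys
sqSum-↭ p = sum-↭ (↭.map⁺ _ p)

sqSum-merge : ∀ xs ys → sqSum (merge _≤?_ xs ys) ≡ sqSum xs + sqSum ys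
sqSum-merge xs ys = trans (sqSum-↭ (↭.merge-↭ _≤?_ xs ys)) (sqSum-++ xs ys)

strictlyIncreasing⇒sorted : ∀ {xs} → StrictlyIncreasing xs → Linked _≤_ xs
strictlyIncreasing⇒sorted = Linked.map ℕ.<⇒≤

strictlyIncreasing⇒unique : ∀ {xs} → StrictlyIncreasing xs → Unique xs
strictlyIncreasing⇒unique = AllPairs.map ℕ.<⇒≢ ∘ Linked.Linked⇒AllPairs ℕ.<-trans

sorted∧unique⇒strictlyIncreasing : ∀ {xs} → Linked _≤_ xs → Unique xs → StrictlyIncreasing xs
sorted∧unique⇒strictlyIncreasing []           _                 = []
sorted∧unique⇒strictlyIncreasing [-]          _                 = [-]
sorted∧unique⇒strictlyIncreasing (x≤y ∷ sort) ((x≢y ∷ _) ∷ uniq) =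
  ℕ.≤∧≢⇒< x≤y x≢y ∷ sorted∧unique⇒strictlyIncreasing sort uniq

map-*-strictlyIncreasing : ∀ a {xs} → StrictlyIncreasing xs → StrictlyIncreasing (map (suc a *_) xs)
map-*-strictlyIncreasing a = Linked.map⁺ ∘ Linked.map (ℕ.*-monoʳ-< (suc a))

merge-strictlyIncreasing : ∀ {xs ys} → StrictlyIncreasing xs → StrictlyIncreasing ys →
  Disjoint xs ys → StrictlyIncreasing (merge _≤?_ xs ys)
merge-strictlyIncreasing {xs} {ys} xs-inc ys-inc xs#ys = sorted∧unique⇒strictlyIncreasing
  (merge⁺ ≤-decTotalOrder (strictlyIncreasing⇒sorted xs-inc) (strictlyIncreasing⇒sorted ys-inc))
  (↭ₛ.Unique-resp-↭ (setoid ℕ) (↭⇒↭ₛ (↭-sym (↭.merge-↭ _≤?_ xs ys)))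
    (Unique.++⁺ (strictlyIncreasing⇒unique xs-inc) (strictlyIncreasing⇒unique ys-inc) xs#ys))

separated⇒disjoint : ∀ {P Q : ℕ → Set} {xs ys} → (∀ {x} → P x → ¬ Q x) →
  All P xs → All Q ys → Disjoint xs ys
separated⇒disjoint P⇒¬Q pxs qys (x∈xs , x∈ys) = P⇒¬Q (All.lookup pxs x∈xs) (All.lookup qys x∈ys)

large-multiple-excluded : ∀ {n k z} → n ≤ z × k ∣ z → ¬ (z < n ⊎ ¬ (k ∣ z))
large-multiple-excluded (n≤z , _)   (inj₁ z<n) = ℕ.<⇒≱ z<n n≤z
large-multiple-excluded (_   , k∣z) (inj₂ k∤z) = k∤z k∣z

scaled-large-multiple : ∀ {t x} k → t ≤ x → t * k ≤ k * x × k ∣ k * x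
scaled-large-multiple {t} {x} k t≤x =
  subst (_≤ k * x) (ℕ.*-comm k t) (ℕ.*-monoʳ-≤ k t≤x) , m∣m*n x

lemma4 : (t : ℕ) → 1 ≤ t → (m : ℕ) → Representable t m →
    (k : ℕ) → (ys : List ℕ) → IsTranslation t k ys →
    Representable t (sc k * m + sh ys)
lemma4 t _ m (X , X-inc , X≥t , X-recip , X-sq) k@(suc a) ys (_ , ys-recip , ys≥t , ys-inc , ys-new) =
  Z , Z-inc , Z≥t , Z-recip , Z-sq
  where
  open ≡-Reasoning
  kX = map (k *_) X
  Z = merge _≤?_ kX ys

  Z-inc : StrictlyIncreasing Z
  Z-inc = merge-strictlyIncreasing (map-*-strictlyIncreasing a X-inc) ys-inc
    (separated⇒disjoint large-multiple-excluded
      (All.map⁺ {P = λ z → t * k ≤ z × k ∣ z} (All.map (scaled-large-multiple k) X≥t)) ys-new)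

  Z≥t : All (t ≤_) Z
  Z≥t = ↭.All-resp-↭ (↭-sym (↭.merge-↭ _≤?_ kX ys))
    (All.++⁺ (All.map⁺ (All.map (λ {x} t≤x → ℕ.≤-trans t≤x (ℕ.m≤n*m x k)) X≥t)) ys≥t)

  Z-recip : recipSum Z ≡ 1ℚ
  Z-recip = begin
    recipSum Z                        ≡⟨ recipSum-merge kX ys ⟩
    recipSum kX +ℚ recipSum ys        ≡⟨ cong₂ _+ℚ_ (recipSum-map-* a X) (sym ys-recip) ⟩
    recip k *ℚ recipSum X +ℚ (1ℚ -ℚ recip k)
      ≡⟨ cong (λ s → recip k *ℚ s +ℚ (1ℚ -ℚ recip k)) X-recip ⟩
    recip k *ℚ 1ℚ +ℚ (1ℚ -ℚ recip k) ≡⟨ cong (_+ℚ (1ℚ -ℚ recip k)) (ℚ.*-identityʳ (recip k)) ⟩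
    recip k +ℚ (1ℚ -ℚ recip k)        ≡⟨ +-[-]-cancel (recip k) 1ℚ ⟩
    1ℚ                                ∎

  Z-sq : sqSum Z ≡ sc k * m + sh ys
  Z-sq = begin
    sqSum Z                    ≡⟨ sqSum-merge kX ys ⟩
    sqSum kX + sqSum ys        ≡⟨ cong (_+ sqSum ys) (sqSum-map-* k X) ⟩
    k * k * sqSum X + sqSum ys ≡⟨ cong (λ s → k * k * s + sqSum ys) X-sq ⟩
    k * k * m + sqSum ys       ∎
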